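{- Let $n\ge 3$, let $1\le k\le n$, and let $A=(a_{pq})$ be an $n\times n$ matrix. Then $$S(A;n,k)=a_{11}\,S(\overline{A}_{11};n-1,k-1)+\sum_{j=2}^{n} a_{1j}\,S(\overline{A}_{1j};n-1,k).$$
   Context: $\mathcal{S}^{(N)}$ is the symmetric group on $\{1,\dots,N\}$, and $\gamma(s)$ is the number of cycles of $s$ including fixed points. For a square matrix $B=(b_{pq})$ of order $N$ and an integer $k$, the Stirling function is $S(B;N,k)=\sum_{s\in\mathcal{S}^{(N)},\,\gamma(s)=k}\prod_{p=1}^{N} b_{p,s(p)}$ (an empty sum is $0$). For an $n\times n$ matrix $A$ with columns $c_1,\dots,c_n$: $\overline{A}_{11}$ is the submatrix obtained by deleting row $1$ and column $1$; for $2\le j\le n$, $\overline{A}_{1j}$ is the $(n-1)\times(n-1)$ matrix obtained by deleting row $1$ and column $j$ and arranging the remaining columns in the order $c_2,c_3,\dots,c_{j-1},c_1,c_{j+1},\dots,c_n$; explicitly its $(p,q)$ entry is $a_{p+1,\psi(q)}$ with $\psi(q)=q+1$ for $q\ne j-1$ and $\psi(j-1)=1$. -}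

module Defs where

open import Level using (Level)
open import Algebra.Bundles using (CommutativeRing)
open import Data.Nat using (ℕ; zero; suc; _≤_)
open import Data.Nat.Properties using (_≤?_)
open import Data.Fin using (Fin; zero; suc; toℕ; _≟_)
open import Data.Fin.Properties using (all?)
open import Data.List using (List; []; _∷_; [_]; map; concatMap; filter; length; foldr; allFin)
open import Data.Product using (_×_)
open import Relation.Nullary.Decidable using (_→-dec_; _×-dec_; yes; no)
open import Relation.Binary.PropositionalEquality using (_≡_)
open import Data.Nat using () renaming (_≟_ to _≟ℕ_)

allFuns : (m N : ℕ) → List (Fin m → Fin N)
allFuns zero    N = [ (λ ()) ]
allFuns (suc m) N =
  concatMap (λ f → map (λ i → λ { zero → i ; (suc x) → f x }) (allFin N)) (allFuns m N)

IsPerm : {N : ℕ} → (Fin N → Fin N) → Set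
IsPerm {N} s = ∀ p q → s p ≡ s q → p ≡ q

isPerm? : {N : ℕ} (s : Fin N → Fin N) → Relation.Nullary.Decidable.Dec (IsPerm s)
isPerm? s = all? (λ p → all? (λ q → (s p ≟ s q) →-dec (p ≟ q)))

iter : {N : ℕ} → (Fin N → Fin N) → ℕ → Fin N → Fin N
iter s zero    p = p
iter s (suc i) p = s (iter s i p)

CycleMin : {N : ℕ} → (Fin N → Fin N) → Fin N → Set
CycleMin {N} s p = ∀ (i : Fin N) → toℕ p ≤ toℕ (iter s (toℕ i) p)

cycleMin? : {N : ℕ} (s : Fin N → Fin N) (p : Fin N) → Relation.Nullary.Decidable.Dec (CycleMin s p)
cycleMin? s p = all? (λ i → toℕ p ≤? toℕ (iter s (toℕ i) p))

-- γ(s): number of cycles (including fixed points) = number of cycle minima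
γ : {N : ℕ} → (Fin N → Fin N) → ℕ
γ {N} s = length (filter (cycleMin? s) (allFin N))

permsWithCycles : (N k : ℕ) → List (Fin N → Fin N)
permsWithCycles N k = filter (λ s → isPerm? s ×-dec (γ s ≟ℕ k)) (allFuns N N)

module _ {c ℓ : Level} (R : CommutativeRing c ℓ) where
  open CommutativeRing R using (Carrier; _+_; _*_; 0#; 1#)

  Matrix : ℕ → Set c
  Matrix N = Fin N → Fin N → Carrier

  sumL : {X : Set} → List X → (X → Carrier) → Carrier
  sumL xs f = foldr (λ x acc → f x + acc) 0# xs

  prodL : {X : Set} → List X → (X → Carrier) → Carrier
  prodL xs f = foldr (λ x acc → f x * acc) 1# xs

  Stirling : (N : ℕ) → Matrix N → ℕ → Carrier
  Stirling N B k = sumL (permsWithCycles N k) (λ s → prodL (allFin N) (λ p → B p (s p)))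

  minor11 : {m : ℕ} → Matrix (suc m) → Matrix m
  minor11 A p q = A (suc p) (suc q)

  -- \bar A_{1j} for j = toℕ j' + 2 (1-based), j' : Fin m:
  -- (p,q) entry a_{p+1,ψ(q)}, ψ(q)=q+1 for q ≠ j-1, ψ(j-1)=1 (converted to 0-based)
  minor1j : {m : ℕ} → Matrix (suc m) → Fin m → Matrix m
  minor1j A j' p q with q ≟ j'
  ... | yes _ = A (suc p) zero
  ... | no  _ = A (suc p) (suc q)

-- Expand along the first row. A permutation s of Fin (suc m) with s 0 = i has the form
-- i ∷ (h ∘ g) with g a permutation of Fin m, where h = suc for i = 0 and h = (0 i) ∘ suc
-- otherwise; its weight is A 0 i times the weight of g in the matching minor (for i = suc j the
-- column order of Ā_{1j} is exactly the transposition (0 i)). For i = 0, s is g with the fixed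
-- point 0 added, so it has one cycle more. For i = suc j, s is g with 0 inserted into the cycle
-- through j just before suc j, so the number of cycles is unchanged. Cycles are counted by their
-- minima: 0 is a new minimum, and in the second case the cycle through j loses its old minimum
-- (each cycle has exactly one).
module Submission where

open import Defs
open import Level using (Level; _⊔_)
open import Algebra.Bundles using (CommutativeRing)
import Data.Fin.Permutation as Permutation
open import Data.Nat using (ℕ; zero; suc; _∸_; _≤_; _<_; s≤s; z≤n) renaming (_≟_ to _≟ℕ_)
import Data.Nat.Properties as ℕ
open import Data.Nat.Properties
  using (_≤?_; n<1+n; ≤-trans; ≤-pred; ≤-antisym; ≤-reflexive; ≰⇒>; m≤n+m; +-suc; +-comm; *-suc;
         m≤n⇒∃[o]m+o≡n)
open import Data.Nat.DivMod using (m≡m%n+[m/n]*n; m%n<n)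
open import Data.Fin as Fin using (Fin; zero; suc; toℕ; fromℕ<)
open import Data.Fin.Properties
  using (pigeonhole; _≟_; toℕ<n; toℕ-fromℕ<; toℕ-injective; suc-injective; 0≢1+n; any?; ¬∀⟶∃¬)
open import Data.Fin.Induction using (<-wellFounded)
open import Data.List using (List; []; _∷_; _++_; length; filter; map; concatMap; tabulate; allFin)
open import Data.List.Properties using (filter-≐; map-tabulate; foldr-map)
open import Data.Product using (∃; _×_; _,_; proj₁)
open import Data.Empty using (⊥-elim)
open import Data.Vec.Functional using () renaming (_∷_ to _∷ᶠ_)
import Algebra.Properties.CommutativeMonoid.Sum as MonoidSum
import Algebra.Properties.CommutativeSemigroup as SemigroupProperties
open import Data.Fin.Permutation.Components using (transpose)
open import Function using (_∘_; id)
open import Function.Definitions using (Injective)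
open import Induction.WellFounded using (Acc; acc)
open import Relation.Nullary using (Dec; ¬_; yes; no)
open import Relation.Nullary.Decidable using (map′; _×-dec_)
open import Relation.Unary using (Pred; Decidable)
open import Relation.Unary.Properties using (_∩?_; ∁?)
import Relation.Binary.Reasoning.Setoid as SetoidReasoning
open import Relation.Binary.PropositionalEquality
  using (_≡_; _≢_; _≗_; refl; sym; trans; cong; subst; module ≡-Reasoning)

-- ℕ's _+_ and _*_ are opened only in this block: in the ring part they denote the ring operations.
module _ where
  open import Data.Nat using (_+_; _*_; _%_; _/_)

  module _ {a p} {A : Set a} {P : Pred A p} (P? : Decidable P) where

    length-filter-map : ∀ {b} {B : Set b} (f : B → A) xs →
                        length (filter P? (map f xs)) ≡ length (filter (P? ∘ f) xs)
    length-filter-map f [] = refl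
    length-filter-map f (x ∷ xs) with P? (f x)
    ... | yes _ = cong suc (length-filter-map f xs)
    ... | no  _ = length-filter-map f xs

    length-filter-partition : ∀ {q} {Q : Pred A q} (Q? : Decidable Q) xs →
      length (filter P? xs) ≡ length (filter (P? ∩? Q?) xs) + length (filter (P? ∩? ∁? Q?) xs)
    length-filter-partition Q? [] = refl
    length-filter-partition Q? (x ∷ xs) with P? x | Q? x
    ... | yes _ | yes _ = cong suc (length-filter-partition Q? xs)
    ... | yes _ | no  _ = trans (cong suc (length-filter-partition Q? xs)) (sym (+-suc _ _))
    ... | no  _ | yes _ = length-filter-partition Q? xs
    ... | no  _ | no  _ = length-filter-partition Q? xs

  tabulate-suc : ∀ n → tabulate {n = n} Fin.suc ≡ map Fin.suc (allFin n)
  tabulate-suc n = sym (map-tabulate id suc)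

  count-tabulate-suc : ∀ {n p} {P : Pred (Fin (suc n)) p} (P? : Decidable P) →
    length (filter P? (tabulate Fin.suc)) ≡ length (filter (P? ∘ suc) (allFin n))
  count-tabulate-suc {n} P? =
    trans (cong (length ∘ filter P?) (tabulate-suc n)) (length-filter-map P? suc (allFin n))

  module _ {n p} {P : Pred (Fin (suc n)) p} (P? : Decidable P) where

    count-allFin-suc-accept : P zero →
      length (filter P? (allFin (suc n))) ≡ suc (length (filter (P? ∘ suc) (allFin n)))
    count-allFin-suc-accept P0 with P? zero
    ... | yes _  = cong suc (count-tabulate-suc P?)
    ... | no ¬P0 = ⊥-elim (¬P0 P0)

    count-allFin-suc-reject : ¬ P zero →
      length (filter P? (allFin (suc n))) ≡ length (filter (P? ∘ suc) (allFin n))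
    count-allFin-suc-reject ¬P0 with P? zero
    ... | yes P0 = ⊥-elim (¬P0 P0)
    ... | no  _  = count-tabulate-suc P?

  count-allFin-none : ∀ {n p} {P : Pred (Fin n) p} (P? : Decidable P) →
    (∀ x → ¬ P x) → length (filter P? (allFin n)) ≡ 0
  count-allFin-none {zero}  P? ¬P = refl
  count-allFin-none {suc n} P? ¬P =
    trans (count-allFin-suc-reject P? (¬P zero)) (count-allFin-none (P? ∘ suc) (¬P ∘ suc))

  count-allFin-unique : ∀ {n p} {P : Pred (Fin n) p} (P? : Decidable P) {q} →
    P q → (∀ {x} → P x → x ≡ q) → length (filter P? (allFin n)) ≡ 1
  count-allFin-unique {suc n} P? {zero} Pq unique =
    trans (count-allFin-suc-accept P? Pq)
          (cong suc (count-allFin-none (P? ∘ suc) (λ x Px → 0≢1+n (sym (unique Px)))))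
  count-allFin-unique {suc n} P? {suc q} Pq unique =
    trans (count-allFin-suc-reject P? (λ P0 → 0≢1+n (unique P0)))
          (count-allFin-unique (P? ∘ suc) Pq (suc-injective ∘ unique))

  module _ {N : ℕ} (s : Fin N → Fin N) where

    iter-+ : ∀ a b p → iter s (a + b) p ≡ iter s a (iter s b p)
    iter-+ zero    b p = refl
    iter-+ (suc a) b p = cong s (iter-+ a b p)

    iter-sucʳ : ∀ i p → iter s (suc i) p ≡ iter s i (s p)
    iter-sucʳ zero    p = refl
    iter-sucʳ (suc i) p = cong s (iter-sucʳ i p)

    iter-* : ∀ {d p} → iter s d p ≡ p → ∀ c → iter s (c * d) p ≡ p
    iter-* e zero    = refl
    iter-* {d} {p} e (suc c) = trans (iter-+ d (c * d) p) (trans (cong (iter s d) (iter-* e c)) e)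

    iter-% : ∀ {d p} → iter s (suc d) p ≡ p → ∀ i → iter s (i % suc d) p ≡ iter s i p
    iter-% {d} {p} e i = sym (begin
      iter s i p
        ≡⟨ cong (λ x → iter s x p) (m≡m%n+[m/n]*n i (suc d)) ⟩
      iter s (i % suc d + i / suc d * suc d) p
        ≡⟨ iter-+ (i % suc d) _ p ⟩
      iter s (i % suc d) (iter s (i / suc d * suc d) p)
        ≡⟨ cong (iter s (i % suc d)) (iter-* e (i / suc d)) ⟩
      iter s (i % suc d) p ∎)
      where open ≡-Reasoning

    iter-injective : IsPerm s → ∀ i {p q} → iter s i p ≡ iter s i q → p ≡ q
    iter-injective s-perm zero    e = e
    iter-injective s-perm (suc i) e = iter-injective s-perm i (s-perm _ _ e)

    Reaches : Fin N → Fin N → Set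
    Reaches p q = ∃ λ i → iter s i p ≡ q

    reaches-refl : ∀ {p} → Reaches p p
    reaches-refl = 0 , refl

    reaches-trans : ∀ {p q r} → Reaches p q → Reaches q r → Reaches p r
    reaches-trans {p} (a , p↝q) (b , q↝r) =
      b + a , trans (iter-+ b a p) (trans (cong (iter s b) p↝q) q↝r)

    module _ (s-perm : IsPerm s) where

      period : ∀ p → ∃ λ d → d < N × iter s (suc d) p ≡ p
      period p with pigeonhole (n<1+n N) (λ (i : Fin (suc N)) → iter s (toℕ i) p)
      ... | i , j , i<j , e with m≤n⇒∃[o]m+o≡n i<j
      ... | d , i+1+d≡j = d , d<N , sym (iter-injective s-perm (toℕ i) shifted)
        where
        d<N : d < N
        d<N = ≤-trans (s≤s (m≤n+m d (toℕ i)))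
                      (≤-trans (≤-reflexive i+1+d≡j) (≤-pred (toℕ<n j)))
        shifted : iter s (toℕ i) p ≡ iter s (toℕ i) (iter s (suc d) p)
        shifted = trans e (trans (cong (λ x → iter s x p) (trans (sym i+1+d≡j) (sym (+-suc (toℕ i) d))))
                                 (iter-+ (toℕ i) (suc d) p))

      iter-bounded : ∀ i p → ∃ λ (i′ : Fin N) → iter s (toℕ i′) p ≡ iter s i p
      iter-bounded i p with period p
      ... | d , d<N , e =
        fromℕ< bound , trans (cong (λ x → iter s x p) (toℕ-fromℕ< bound)) (iter-% e i)
        where bound = ≤-trans (m%n<n i (suc d)) d<N

      reaches-sym : ∀ {p q} → Reaches p q → Reaches q p
      reaches-sym {p} (c , refl) with period p
      ... | d , _ , e = c * d , (begin
        iter s (c * d) (iter s c p) ≡⟨ sym (iter-+ (c * d) c p) ⟩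
        iter s (c * d + c) p        ≡⟨ cong (λ x → iter s x p) (trans (+-comm (c * d) c) (sym (*-suc c d))) ⟩
        iter s (c * suc d) p        ≡⟨ iter-* e c ⟩
        p                           ∎)
        where open ≡-Reasoning

      reaches-suc : ∀ {p q} → Reaches p q → ∃ λ i → iter s (suc i) p ≡ q
      reaches-suc {p} (c , refl) with period p
      ... | d , _ , e = c + d , trans (cong (λ x → iter s x p) (sym (+-suc c d)))
                                      (trans (iter-+ c (suc d) p) (cong (iter s c) e))

      reaches? : ∀ q → Decidable (λ p → Reaches p q)
      reaches? q p = map′ (λ (i , e) → toℕ i , e)
                          (λ (i , e) → let (i′ , e′) = iter-bounded i p in i′ , trans e′ e)
                          (any? (λ i → iter s (toℕ i) p ≟ q))

  iter-cong : ∀ {N} {s s′ : Fin N → Fin N} → s ≗ s′ → ∀ i → iter s i ≗ iter s′ i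
  iter-cong s≗s′ zero    p = refl
  iter-cong {s = s} s≗s′ (suc i) p = trans (cong s (iter-cong s≗s′ i p)) (s≗s′ _)

  isPerm-cong : ∀ {N} {s s′ : Fin N → Fin N} → s ≗ s′ → IsPerm s → IsPerm s′
  isPerm-cong s≗s′ s-perm p q e = s-perm p q (trans (s≗s′ p) (trans e (sym (s≗s′ q))))

  γ-cong : ∀ {N} {s s′ : Fin N → Fin N} → s ≗ s′ → γ s ≡ γ s′
  γ-cong {N} {s} {s′} s≗s′ =
    cong length (filter-≐ (cycleMin? s) (cycleMin? s′) (along s≗s′ , along (sym ∘ s≗s′)) (allFin N))
    where
    along : ∀ {s s′ : Fin N → Fin N} → s ≗ s′ → ∀ {p} → CycleMin s p → CycleMin s′ p
    along s≗s′ {p} min i = subst (λ q → toℕ p ≤ toℕ q) (iter-cong s≗s′ (toℕ i) p) (min i)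

  module _ {N : ℕ} {s : Fin N → Fin N} (s-perm : IsPerm s) where

    cycleMin-≤-iter : ∀ {p} → CycleMin s p → ∀ i → toℕ p ≤ toℕ (iter s i p)
    cycleMin-≤-iter {p} min i with iter-bounded s s-perm i p
    ... | i′ , e = subst (λ q → toℕ p ≤ toℕ q) e (min i′)

    cycleMin-unique : ∀ {p q} → CycleMin s p → CycleMin s q → Reaches s p q → p ≡ q
    cycleMin-unique {p} {q} p-min q-min p↝q@(i , e) with reaches-sym s s-perm p↝q
    ... | i′ , e′ = toℕ-injective (≤-antisym
      (subst (λ r → toℕ p ≤ toℕ r) e  (cycleMin-≤-iter p-min i))
      (subst (λ r → toℕ q ≤ toℕ r) e′ (cycleMin-≤-iter q-min i′)))

    cycleMin-reaching : ∀ j → ∃ λ q → CycleMin s q × Reaches s q j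
    cycleMin-reaching j = descend j (<-wellFounded j) (reaches-refl s)
      where
      descend : ∀ p → Acc Fin._<_ p → Reaches s p j → ∃ λ q → CycleMin s q × Reaches s q j
      descend p (acc smaller) p↝j with cycleMin? s p
      ... | yes p-min = p , p-min , p↝j
      ... | no ¬p-min with ¬∀⟶∃¬ N _ (λ i → toℕ p ≤? toℕ (iter s (toℕ i) p)) ¬p-min
      ... | i , p≰ = descend (iter s (toℕ i) p) (smaller (≰⇒> p≰))
                             (reaches-trans s (reaches-sym s s-perm (toℕ i , refl)) p↝j)

    γ-cycleThrough : ∀ j → γ s ≡ suc (length (filter (cycleMin? s ∩? ∁? (reaches? s s-perm j)) (allFin N)))
    γ-cycleThrough j with cycleMin-reaching j
    ... | q , q-min , q↝j = trans (length-filter-partition (cycleMin? s) (reaches? s s-perm j) (allFin N))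
      (cong (_+ length (filter (cycleMin? s ∩? ∁? (reaches? s s-perm j)) (allFin N)))
            (count-allFin-unique (cycleMin? s ∩? reaches? s s-perm j) (q-min , q↝j) unique))
      where
      unique : ∀ {p} → CycleMin s p × Reaches s p j → p ≡ q
      unique (p-min , p↝j) = cycleMin-unique p-min q-min (reaches-trans s p↝j (reaches-sym s s-perm q↝j))

  module _ {m : ℕ} {s : Fin (suc m) → Fin (suc m)} {g : Fin m → Fin m} {p : Fin m}
           (s-lifts-g : ∀ i → iter s i (suc p) ≡ suc (iter g i p)) where

    cycleMin-lift⁺ : IsPerm g → CycleMin g p → CycleMin s (suc p)
    cycleMin-lift⁺ g-perm p-min i =
      subst (λ q → toℕ (suc p) ≤ toℕ q) (sym (s-lifts-g (toℕ i)))
            (s≤s (cycleMin-≤-iter g-perm p-min (toℕ i)))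

    cycleMin-lift⁻ : IsPerm s → CycleMin s (suc p) → CycleMin g p
    cycleMin-lift⁻ s-perm sp-min i =
      ≤-pred (subst (λ q → toℕ (suc p) ≤ toℕ q) (s-lifts-g (toℕ i))
                    (cycleMin-≤-iter s-perm sp-min (toℕ i)))

  cycleMin-zero : ∀ {N} (s : Fin (suc N) → Fin (suc N)) → CycleMin s zero
  cycleMin-zero s i = z≤n

  module _ {m : ℕ} {i : Fin (suc m)} {h : Fin m → Fin (suc m)} (h-injective : Injective _≡_ _≡_ h)
    where

    isPerm-∷ : ∀ {t} → (∀ x → h x ≢ i) → IsPerm t → IsPerm (i ∷ᶠ (h ∘ t))
    isPerm-∷ h≢i t-perm zero    zero    e = refl
    isPerm-∷ h≢i t-perm zero    (suc q) e = ⊥-elim (h≢i _ (sym e))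
    isPerm-∷ h≢i t-perm (suc p) zero    e = ⊥-elim (h≢i _ e)
    isPerm-∷ h≢i t-perm (suc p) (suc q) e = cong suc (t-perm p q (h-injective e))

    isPerm-∷⁻ : ∀ {t} → IsPerm (i ∷ᶠ (h ∘ t)) → IsPerm t
    isPerm-∷⁻ s-perm p q e = suc-injective (s-perm (suc p) (suc q) (cong h e))

  ∷-congʳ : ∀ {n} {A : Set} (x : A) {f g : Fin n → A} → f ≗ g → (x ∷ᶠ f) ≗ (x ∷ᶠ g)
  ∷-congʳ x f≗g zero    = refl
  ∷-congʳ x f≗g (suc y) = f≗g y

  ∷-¬isPerm : ∀ {N i} {f : Fin N → Fin (suc N)} x → f x ≡ i → ¬ IsPerm (i ∷ᶠ f)
  ∷-¬isPerm x fx≡i s-perm = 0≢1+n (s-perm zero (suc x) (sym fx≡i))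

  addFixedPoint : ∀ {m} → (Fin m → Fin m) → Fin (suc m) → Fin (suc m)
  addFixedPoint g = zero ∷ᶠ (suc ∘ g)

  module _ {m : ℕ} {g : Fin m → Fin m} (g-perm : IsPerm g) where

    private
      s = addFixedPoint g
      s-perm : IsPerm s
      s-perm = isPerm-∷ suc-injective (λ x ()) g-perm

    iter-addFixedPoint : ∀ p i → iter (addFixedPoint g) i (suc p) ≡ suc (iter g i p)
    iter-addFixedPoint p zero    = refl
    iter-addFixedPoint p (suc i) = cong s (iter-addFixedPoint p i)

    γ-addFixedPoint : γ (addFixedPoint g) ≡ suc (γ g)
    γ-addFixedPoint = trans (count-allFin-suc-accept (cycleMin? s) (cycleMin-zero s))
      (cong (suc ∘ length) (filter-≐ (cycleMin? s ∘ suc) (cycleMin? g)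
        ((λ {p} → cycleMin-lift⁻ (iter-addFixedPoint p) s-perm) ,
         (λ {p} → cycleMin-lift⁺ (iter-addFixedPoint p) g-perm))
        (allFin m)))

  module _ {m : ℕ} (j : Fin m) where

    transpose₀-suc-self : transpose zero (suc j) (suc j) ≡ zero
    transpose₀-suc-self with j ≟ j
    ... | yes _   = refl
    ... | no j≢j = ⊥-elim (j≢j refl)

    transpose₀-suc-≢ : ∀ {q} → q ≢ j → transpose zero (suc j) (suc q) ≡ suc q
    transpose₀-suc-≢ {q} q≢j with q ≟ j
    ... | yes q≡j = ⊥-elim (q≢j q≡j)
    ... | no  _   = refl

    transpose₀-injective : Injective _≡_ _≡_ (transpose zero (suc j))
    transpose₀-injective e = trans (sym (inverseˡ π)) (trans (cong (π ⟨$⟩ˡ_) e) (inverseˡ π))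
      where
      open Permutation using (_⟨$⟩ˡ_; inverseˡ)
      π = Permutation.transpose zero (suc j)

    -- If t x = j then suc x ↦ 0 ↦ suc j; every other suc x ↦ suc (t x).
    insertBefore : (Fin m → Fin m) → Fin (suc m) → Fin (suc m)
    insertBefore t = suc j ∷ᶠ (transpose zero (suc j) ∘ suc ∘ t)

    transpose₀∘suc-injective : Injective _≡_ _≡_ (transpose zero (suc j) ∘ suc)
    transpose₀∘suc-injective = suc-injective ∘ transpose₀-injective

    transpose₀∘suc-≢ : ∀ x → transpose zero (suc j) (suc x) ≢ suc j
    transpose₀∘suc-≢ x e = 0≢1+n (sym (transpose₀-injective e))

    module _ {t : Fin m → Fin m} (t-perm : IsPerm t) where

      private
        s = insertBefore t
        s-perm : IsPerm s
        s-perm = isPerm-∷ transpose₀∘suc-injective transpose₀∘suc-≢ t-perm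

      iter-insertBefore : ∀ {p} → ¬ Reaches t p j → ∀ i → iter (insertBefore t) i (suc p) ≡ suc (iter t i p)
      iter-insertBefore p↛j zero    = refl
      iter-insertBefore p↛j (suc i) =
        trans (cong s (iter-insertBefore p↛j i)) (transpose₀-suc-≢ (λ e → p↛j (suc i , e)))

      insertBefore-reachesZero : ∀ i p → iter t (suc i) p ≡ j → Reaches (insertBefore t) (suc p) zero
      insertBefore-reachesZero i p e with t p ≟ j
      insertBefore-reachesZero i       p e | yes tp≡j =
        1 , trans (cong (transpose zero (suc j) ∘ suc) tp≡j) transpose₀-suc-self
      insertBefore-reachesZero zero    p e | no  tp≢j = ⊥-elim (tp≢j e)
      insertBefore-reachesZero (suc i) p e | no  tp≢j =
        reaches-trans s (1 , transpose₀-suc-≢ tp≢j)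
                        (insertBefore-reachesZero i (t p) (trans (sym (iter-sucʳ t (suc i) p)) e))

      γ-insertBefore : γ (insertBefore t) ≡ γ t
      γ-insertBefore = trans (count-allFin-suc-accept (cycleMin? s) (cycleMin-zero s))
        (trans (cong (suc ∘ length) (filter-≐ (cycleMin? s ∘ suc)
                                               (cycleMin? t ∩? ∁? (reaches? t t-perm j))
                                               ((λ {p} → to p) , (λ {p} → from p)) (allFin m)))
               (sym (γ-cycleThrough t-perm j)))
        where
        to : ∀ p → CycleMin s (suc p) → CycleMin t p × ¬ Reaches t p j
        to p sp-min = cycleMin-lift⁻ (iter-insertBefore p↛j) s-perm sp-min , p↛j
          where
          p↛j : ¬ Reaches t p j
          p↛j p↝j with reaches-suc t t-perm p↝j
          ... | i , e with insertBefore-reachesZero i p e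
          ... | x , sp↝0 with subst (λ q → toℕ (suc p) ≤ toℕ q) sp↝0
                                   (cycleMin-≤-iter s-perm sp-min x)
          ... | ()
        from : ∀ p → CycleMin t p × ¬ Reaches t p j → CycleMin s (suc p)
        from p (p-min , p↛j) = cycleMin-lift⁺ (iter-insertBefore p↛j) t-perm p-min

module _ {c ℓ : Level} (R : CommutativeRing c ℓ) where

  open CommutativeRing R
    using (Carrier; _≈_; _+_; _*_; 0#; 1#; setoid; reflexive; +-cong; *-cong; +-congˡ; +-congʳ; *-congˡ;
           +-identityˡ; +-assoc; zeroʳ; distribˡ; +-commutativeMonoid; +-commutativeSemigroup)
    renaming (refl to ≈-refl; sym to ≈-sym; trans to ≈-trans)
  open SetoidReasoning setoid
  open SemigroupProperties +-commutativeSemigroup using (interchange)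

  module _ {X : Set} where

    sumL-cong : ∀ (xs : List X) {f g : X → Carrier} → (∀ x → f x ≈ g x) → sumL R xs f ≈ sumL R xs g
    sumL-cong []       f≈g = ≈-refl
    sumL-cong (x ∷ xs) f≈g = +-cong (f≈g x) (sumL-cong xs f≈g)

    prodL-cong : ∀ (xs : List X) {f g : X → Carrier} → (∀ x → f x ≈ g x) → prodL R xs f ≈ prodL R xs g
    prodL-cong []       f≈g = ≈-refl
    prodL-cong (x ∷ xs) f≈g = *-cong (f≈g x) (prodL-cong xs f≈g)

    sumL-0 : ∀ (xs : List X) {f : X → Carrier} → (∀ x → f x ≈ 0#) → sumL R xs f ≈ 0#
    sumL-0 []       f≈0 = ≈-refl
    sumL-0 (x ∷ xs) f≈0 = ≈-trans (+-cong (f≈0 x) (sumL-0 xs f≈0)) (+-identityˡ 0#)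

    sumL-++ : ∀ (xs ys : List X) (f : X → Carrier) → sumL R (xs ++ ys) f ≈ sumL R xs f + sumL R ys f
    sumL-++ []       ys f = ≈-sym (+-identityˡ _)
    sumL-++ (x ∷ xs) ys f = ≈-trans (+-congˡ (sumL-++ xs ys f)) (≈-sym (+-assoc _ _ _))

    sumL-+ : ∀ (xs : List X) (f g : X → Carrier) →
             sumL R xs (λ x → f x + g x) ≈ sumL R xs f + sumL R xs g
    sumL-+ []       f g = ≈-sym (+-identityˡ _)
    sumL-+ (x ∷ xs) f g = ≈-trans (+-congˡ (sumL-+ xs f g)) (interchange _ _ _ _)

    sumL-*ˡ : ∀ (xs : List X) (a : Carrier) (f : X → Carrier) → sumL R xs (λ x → a * f x) ≈ a * sumL R xs f
    sumL-*ˡ []       a f = ≈-sym (zeroʳ a)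
    sumL-*ˡ (x ∷ xs) a f = ≈-trans (+-congˡ (sumL-*ˡ xs a f)) (≈-sym (distribˡ a _ _))

  sumL-concatMap : ∀ {X Y : Set} (h : X → List Y) (xs : List X) (f : Y → Carrier) →
                   sumL R (concatMap h xs) f ≈ sumL R xs (λ x → sumL R (h x) f)
  sumL-concatMap h []       f = ≈-refl
  sumL-concatMap h (x ∷ xs) f = ≈-trans (sumL-++ (h x) _ f) (+-congˡ (sumL-concatMap h xs f))

  sumL-swap : ∀ {X Y : Set} (xs : List X) (ys : List Y) (f : X → Y → Carrier) →
              sumL R xs (λ x → sumL R ys (f x)) ≈ sumL R ys (λ y → sumL R xs (λ x → f x y))
  sumL-swap []       ys f = ≈-sym (sumL-0 ys (λ _ → ≈-refl))
  sumL-swap (x ∷ xs) ys f = ≈-trans (+-congˡ (sumL-swap xs ys f)) (≈-sym (sumL-+ ys (f x) _))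

  module _ {n : ℕ} (f : Fin (suc n) → Carrier) where

    sumL-allFin-suc : sumL R (allFin (suc n)) f ≡ f zero + sumL R (allFin n) (f ∘ suc)
    sumL-allFin-suc =
      cong (f zero +_) (trans (cong (λ xs → sumL R xs f) (tabulate-suc n)) (foldr-map _ suc 0# (allFin n)))

    prodL-allFin-suc : prodL R (allFin (suc n)) f ≡ f zero * prodL R (allFin n) (f ∘ suc)
    prodL-allFin-suc =
      cong (f zero *_) (trans (cong (λ xs → prodL R xs f) (tabulate-suc n)) (foldr-map _ suc 1# (allFin n)))

    sumL-allFin-dropZero : f zero ≈ 0# → sumL R (allFin (suc n)) f ≈ sumL R (allFin n) (f ∘ suc)
    sumL-allFin-dropZero f0≈0 =
      ≈-trans (reflexive sumL-allFin-suc) (≈-trans (+-congʳ f0≈0) (+-identityˡ _))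

  sumL-allFin-permute : ∀ {n} (π : Permutation.Permutation n n) (f : Fin n → Carrier) →
                        sumL R (allFin n) f ≈ sumL R (allFin n) (f ∘ (π Permutation.⟨$⟩ʳ_))
  sumL-allFin-permute π f =
    ≈-trans (sumL≈sum f) (≈-trans (sum-permute f π) (≈-sym (sumL≈sum (f ∘ (π Permutation.⟨$⟩ʳ_)))))
    where
    open MonoidSum +-commutativeMonoid using (sum; sum-permute)
    sumL≈sum : ∀ {n} (f : Fin n → Carrier) → sumL R (allFin n) f ≈ sum f
    sumL≈sum {zero}  f = ≈-refl
    sumL≈sum {suc n} f = ≈-trans (reflexive (sumL-allFin-suc f)) (+-congˡ (sumL≈sum (f ∘ suc)))

  indicator : ∀ {p} {P : Set p} → Dec P → Carrier → Carrier
  indicator (yes _) x = x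
  indicator (no  _) _ = 0#

  sumL-filter : ∀ {X : Set} {p} {P : Pred X p} (P? : Decidable P) (xs : List X) (f : X → Carrier) →
                sumL R (filter P? xs) f ≈ sumL R xs (λ x → indicator (P? x) (f x))
  sumL-filter P? []       f = ≈-refl
  sumL-filter P? (x ∷ xs) f with P? x
  ... | yes _ = +-congˡ (sumL-filter P? xs f)
  ... | no  _ = ≈-trans (sumL-filter P? xs f) (≈-sym (+-identityˡ _))

  indicator-cong : ∀ {p q} {P : Set p} {Q : Set q} (P? : Dec P) (Q? : Dec Q) → (P → Q) → (Q → P) →
                   ∀ {x y} → x ≈ y → indicator P? x ≈ indicator Q? y
  indicator-cong (yes _) (yes _) P→Q Q→P x≈y = x≈y
  indicator-cong (yes P) (no ¬Q) P→Q Q→P x≈y = ⊥-elim (¬Q (P→Q P))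
  indicator-cong (no ¬P) (yes Q) P→Q Q→P x≈y = ⊥-elim (¬P (Q→P Q))
  indicator-cong (no _)  (no _)  P→Q Q→P x≈y = ≈-refl

  indicator-*ˡ : ∀ {p} {P : Set p} (P? : Dec P) a x → indicator P? (a * x) ≈ a * indicator P? x
  indicator-*ˡ (yes _) a x = ≈-refl
  indicator-*ˡ (no  _) a x = ≈-sym (zeroʳ a)

  indicator-reject : ∀ {p} {P : Set p} (P? : Dec P) → ¬ P → ∀ x → indicator P? x ≈ 0#
  indicator-reject (yes P) ¬P x = ⊥-elim (¬P P)
  indicator-reject (no _)  ¬P x = ≈-refl

  Extensional : ∀ {d N} → ((Fin d → Fin N) → Carrier) → Set ℓ
  Extensional F = ∀ {f g} → f ≗ g → F f ≈ F g

  sumL-allFuns-suc : ∀ {d N} (F : (Fin (suc d) → Fin N) → Carrier) → Extensional F →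
    sumL R (allFuns (suc d) N) F ≈ sumL R (allFuns d N) (λ f → sumL R (allFin N) (λ i → F (i ∷ᶠ f)))
  sumL-allFuns-suc {d} {N} F F-ext =
    ≈-trans (sumL-concatMap _ (allFuns d N) F) (sumL-cong (allFuns d N) λ f →
      ≈-trans (reflexive (foldr-map _ _ 0# (allFin N)))
              (sumL-cong (allFin N) λ i → F-ext λ { zero → refl ; (suc x) → refl }))

  ReindexesAwayFrom : ∀ {M N} → Fin N → (Fin M → Fin N) → Set (c ⊔ ℓ)
  ReindexesAwayFrom {M} {N} i h = ∀ G → G i ≈ 0# → sumL R (allFin N) G ≈ sumL R (allFin M) (G ∘ h)

  sumL-allFuns-reindex : ∀ {M N} (i : Fin N) (h : Fin M → Fin N) → ReindexesAwayFrom i h →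
    ∀ d (F : (Fin d → Fin N) → Carrier) → Extensional F → (∀ f x → f x ≡ i → F f ≈ 0#) →
    sumL R (allFuns d N) F ≈ sumL R (allFuns d M) (λ g → F (h ∘ g))
  sumL-allFuns-reindex i h reindex zero    F F-ext F≈0 = +-congʳ (F-ext λ ())
  sumL-allFuns-reindex {M} {N} i h reindex (suc d) F F-ext F≈0 = begin
    sumL R (allFuns (suc d) N) F
      ≈⟨ sumL-allFuns-suc F F-ext ⟩
    sumL R (allFuns d N) (λ f → sumL R (allFin N) (λ i′ → F (i′ ∷ᶠ f)))
      ≈⟨ sumL-cong (allFuns d N) (λ f → reindex (λ i′ → F (i′ ∷ᶠ f)) (F≈0 (i ∷ᶠ f) zero refl)) ⟩
    sumL R (allFuns d N) (λ f → sumL R (allFin M) (λ i′ → F (h i′ ∷ᶠ f)))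
      ≈⟨ sumL-swap (allFuns d N) (allFin M) _ ⟩
    sumL R (allFin M) (λ i′ → sumL R (allFuns d N) (λ f → F (h i′ ∷ᶠ f)))
      ≈⟨ sumL-cong (allFin M) (λ i′ → sumL-allFuns-reindex i h reindex d (λ f → F (h i′ ∷ᶠ f))
                                        (λ f≗g → F-ext (∷-congʳ (h i′) f≗g)) (λ f x → F≈0 (h i′ ∷ᶠ f) (suc x))) ⟩
    sumL R (allFin M) (λ i′ → sumL R (allFuns d M) (λ g → F (h i′ ∷ᶠ (h ∘ g))))
      ≈⟨ sumL-swap (allFin M) (allFuns d M) _ ⟩
    sumL R (allFuns d M) (λ g → sumL R (allFin M) (λ i′ → F (h i′ ∷ᶠ (h ∘ g))))
      ≈⟨ sumL-cong (allFuns d M) (λ g → sumL-cong (allFin M) (λ i′ → F-ext λ { zero → refl ; (suc x) → refl })) ⟩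
    sumL R (allFuns d M) (λ g → sumL R (allFin M) (λ i′ → F (h ∘ (i′ ∷ᶠ g))))
      ≈⟨ ≈-sym (sumL-allFuns-suc (λ g → F (h ∘ g)) (λ f≗g → F-ext (cong h ∘ f≗g))) ⟩
    sumL R (allFuns (suc d) M) (λ g → F (h ∘ g)) ∎

  weight : ∀ {N} → Matrix R N → (Fin N → Fin N) → Carrier
  weight {N} B s = prodL R (allFin N) (λ p → B p (s p))

  stirlingTerm : ∀ {N} → ℕ → Matrix R N → (Fin N → Fin N) → Carrier
  stirlingTerm k B s = indicator (isPerm? s ×-dec (γ s ≟ℕ k)) (weight B s)

  Stirling≈sumL-stirlingTerm : ∀ N (B : Matrix R N) k →
                               Stirling R N B k ≈ sumL R (allFuns N N) (stirlingTerm k B)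
  Stirling≈sumL-stirlingTerm N B k =
    sumL-filter (λ s → isPerm? s ×-dec (γ s ≟ℕ k)) (allFuns N N) (weight B)

  stirlingTerm-cong : ∀ {N} k (B : Matrix R N) → Extensional (stirlingTerm k B)
  stirlingTerm-cong {N} k B {f} {g} f≗g =
    indicator-cong (isPerm? f ×-dec (γ f ≟ℕ k)) (isPerm? g ×-dec (γ g ≟ℕ k))
      (λ (f-perm , γf≡k) → isPerm-cong f≗g f-perm , trans (sym (γ-cong f≗g)) γf≡k)
      (λ (g-perm , γg≡k) → isPerm-cong (sym ∘ f≗g) g-perm , trans (γ-cong f≗g) γg≡k)
      (prodL-cong (allFin N) (λ p → reflexive (cong (B p) (f≗g p))))

  Stirling-byFirstRow : ∀ {m} (A : Matrix R (suc m)) k → Stirling R (suc m) A k ≈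
    sumL R (allFin (suc m)) (λ i → sumL R (allFuns m (suc m)) (λ f → stirlingTerm k A (i ∷ᶠ f)))
  Stirling-byFirstRow {m} A k = begin
    Stirling R (suc m) A k
      ≈⟨ Stirling≈sumL-stirlingTerm (suc m) A k ⟩
    sumL R (allFuns (suc m) (suc m)) (stirlingTerm k A)
      ≈⟨ sumL-allFuns-suc (stirlingTerm k A) (stirlingTerm-cong k A) ⟩
    sumL R (allFuns m (suc m)) (λ f → sumL R (allFin (suc m)) (λ i → stirlingTerm k A (i ∷ᶠ f)))
      ≈⟨ sumL-swap (allFuns m (suc m)) (allFin (suc m)) _ ⟩
    sumL R (allFin (suc m)) (λ i → sumL R (allFuns m (suc m)) (λ f → stirlingTerm k A (i ∷ᶠ f))) ∎

  module _ {m} (A : Matrix R (suc m)) (i : Fin (suc m)) {h : Fin m → Fin (suc m)}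
           (h-injective : Injective _≡_ _≡_ h) (h≢i : ∀ x → h x ≢ i) (reindex : ReindexesAwayFrom i h)
           {shift : ℕ → ℕ} (shift-injective : ∀ {a b} → shift a ≡ shift b → a ≡ b)
           (γ-extend : ∀ {g} → IsPerm g → γ (i ∷ᶠ (h ∘ g)) ≡ shift (γ g))
           (B : Matrix R m) (B≈A : ∀ p q → B p q ≈ A (suc p) (h q)) where

    stirlingTerm-extend : ∀ k g → stirlingTerm (shift k) A (i ∷ᶠ (h ∘ g)) ≈ A zero i * stirlingTerm k B g
    stirlingTerm-extend k g =
      ≈-trans (indicator-cong (isPerm? s ×-dec (γ s ≟ℕ shift k)) (isPerm? g ×-dec (γ g ≟ℕ k)) to from weight-extend)
              (indicator-*ˡ (isPerm? g ×-dec (γ g ≟ℕ k)) _ _)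
      where
      s = i ∷ᶠ (h ∘ g)
      to : IsPerm s × γ s ≡ shift k → IsPerm g × γ g ≡ k
      to (s-perm , γs≡) = g-perm , shift-injective (trans (sym (γ-extend g-perm)) γs≡)
        where g-perm = isPerm-∷⁻ h-injective s-perm
      from : IsPerm g × γ g ≡ k → IsPerm s × γ s ≡ shift k
      from (g-perm , γg≡k) = isPerm-∷ h-injective h≢i g-perm , trans (γ-extend g-perm) (cong shift γg≡k)
      weight-extend : weight A s ≈ A zero i * weight B g
      weight-extend = ≈-trans (reflexive (prodL-allFin-suc (λ p → A p (s p))))
                              (*-congˡ (prodL-cong (allFin m) (λ p → ≈-sym (B≈A p (g p)))))

    firstRow-term : ∀ k → sumL R (allFuns m (suc m)) (λ f → stirlingTerm (shift k) A (i ∷ᶠ f)) ≈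
                          A zero i * Stirling R m B k
    firstRow-term k = begin
      sumL R (allFuns m (suc m)) (λ f → stirlingTerm (shift k) A (i ∷ᶠ f))
        ≈⟨ sumL-allFuns-reindex i h reindex m (λ f → stirlingTerm (shift k) A (i ∷ᶠ f))
                                (λ f≗g → stirlingTerm-cong (shift k) A (∷-congʳ i f≗g)) vanish ⟩
      sumL R (allFuns m m) (λ g → stirlingTerm (shift k) A (i ∷ᶠ (h ∘ g)))
        ≈⟨ sumL-cong (allFuns m m) (stirlingTerm-extend k) ⟩
      sumL R (allFuns m m) (λ g → A zero i * stirlingTerm k B g)
        ≈⟨ sumL-*ˡ (allFuns m m) _ _ ⟩
      A zero i * sumL R (allFuns m m) (stirlingTerm k B)
        ≈⟨ *-congˡ (≈-sym (Stirling≈sumL-stirlingTerm m B k)) ⟩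
      A zero i * Stirling R m B k ∎
      where
      vanish : ∀ f x → f x ≡ i → stirlingTerm (shift k) A (i ∷ᶠ f) ≈ 0#
      vanish f x fx≡i = indicator-reject (isPerm? (i ∷ᶠ f) ×-dec _) (∷-¬isPerm x fx≡i ∘ proj₁) _

  module _ {m} (A : Matrix R (suc m)) where

    firstRow-term₀ : ∀ k → sumL R (allFuns m (suc m)) (λ f → stirlingTerm (suc k) A (zero ∷ᶠ f)) ≈
                           A zero zero * Stirling R m (minor11 R A) k
    firstRow-term₀ = firstRow-term A zero suc-injective (λ x ()) sumL-allFin-dropZero ℕ.suc-injective
                                   γ-addFixedPoint (minor11 R A) (λ p q → ≈-refl)

    minor1j≡transpose₀ : ∀ j p q → minor1j R A j p q ≡ A (suc p) (transpose zero (suc j) (suc q))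
    minor1j≡transpose₀ j p q with q ≟ j
    ... | yes _ = refl
    ... | no  _ = refl

    firstRow-termⱼ : ∀ j k → sumL R (allFuns m (suc m)) (λ f → stirlingTerm k A (suc j ∷ᶠ f)) ≈
                             A zero (suc j) * Stirling R m (minor1j R A j) k
    firstRow-termⱼ j =
      firstRow-term A (suc j) (transpose₀∘suc-injective j) (transpose₀∘suc-≢ j) reindex id (γ-insertBefore j)
                    (minor1j R A j) (λ p q → reflexive (minor1j≡transpose₀ j p q))
      where
      reindex : ReindexesAwayFrom (suc j) (transpose zero (suc j) ∘ suc)
      reindex G Gj≈0 = ≈-trans (sumL-allFin-permute (Permutation.transpose zero (suc j)) G)
                               (sumL-allFin-dropZero (G ∘ transpose zero (suc j)) Gj≈0)

mainTheorem5 : {c ℓ : Level} (R : CommutativeRing c ℓ) →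
    (m : ℕ) → 2 ≤ m → (k : ℕ) → 1 ≤ k → k ≤ suc m → (A : Matrix R (suc m)) →
    CommutativeRing._≈_ R (Stirling R (suc m) A k)
      (CommutativeRing._+_ R
        (CommutativeRing._*_ R (A zero zero) (Stirling R m (minor11 R A) (k ∸ 1)))
        (sumL R (allFin m) (λ j' → CommutativeRing._*_ R (A zero (suc j')) (Stirling R m (minor1j R A j') k))))
mainTheorem5 R m _ (suc k) _ _ A = begin
  Stirling R (suc m) A (suc k)
    ≈⟨ Stirling-byFirstRow R A (suc k) ⟩
  sumL R (allFin (suc m)) column
    ≡⟨ sumL-allFin-suc R column ⟩
  column zero + sumL R (allFin m) (column ∘ suc)
    ≈⟨ +-cong (firstRow-term₀ R A k) (sumL-cong R (allFin m) (λ j → firstRow-termⱼ R A j (suc k))) ⟩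
  A zero zero * Stirling R m (minor11 R A) k +
    sumL R (allFin m) (λ j → A zero (suc j) * Stirling R m (minor1j R A j) (suc k)) ∎
  where
  open CommutativeRing R using (_+_; _*_; +-cong; setoid)
  open SetoidReasoning setoid
  column : Fin (suc m) → CommutativeRing.Carrier R
  column i = sumL R (allFuns m (suc m)) (λ f → stirlingTerm R (suc k) A (i ∷ᶠ f))
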